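{- For every $n\ge 0$ there is an involution $\psi$ on $\mathcal M_n(UU)$ such that for every $P\in\mathcal M_n(UU)$ the number of occurrences of $DD$ in $\psi(P)$ equals the number of occurrences of $UFU$ in $P$. Consequently, the statistics "number of occurrences of $UFU$" and "number of occurrences of $DD$" are equidistributed on $\mathcal M_n(UU)$.
   Context: A Motzkin path of length $n$ is a lattice path from $(0,0)$ to $(n,0)$ with steps $U=(1,1)$, $F=(1,0)$, $D=(1,-1)$ that never goes below the $x$-axis, viewed as a word in $U,F,D$. An occurrence of a word $w$ in a path is a position where $w$ appears as a block of consecutive steps. $\mathcal M_n(UU)$ denotes the set of Motzkin paths of length $n$ containing no occurrence of $UU$. -}

module Defs where

open import Data.Nat using (ℕ; zero; suc; _+_)
open import Data.Bool using (Bool; true; false; _∧_; if_then_else_; T?)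
open import Data.List using (List; []; _∷_; length; filter; concatMap; map)
open import Data.Product using (Σ; _×_; _,_; proj₁)
open import Relation.Binary.PropositionalEquality using (_≡_)
open import Relation.Nullary using (¬_)

-- Steps: U = (1,1), F = (1,0), D = (1,-1)
data Step : Set where
  U F D : Step

Word : Set
Word = List Step

data MotzkinFrom : ℕ → Word → Set where
  done : MotzkinFrom zero []
  up   : ∀ {h w} → MotzkinFrom (suc h) w → MotzkinFrom h (U ∷ w)
  flat : ∀ {h w} → MotzkinFrom h w → MotzkinFrom h (F ∷ w)
  down : ∀ {h w} → MotzkinFrom h w → MotzkinFrom (suc h) (D ∷ w)

IsMotzkin : Word → Set
IsMotzkin = MotzkinFrom zero

_=ˢ_ : Step → Step → Bool
U =ˢ U = true
F =ˢ F = true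
D =ˢ D = true
_ =ˢ _ = false

isPrefix : Word → Word → Bool
isPrefix [] _ = true
isPrefix (_ ∷ _) [] = false
isPrefix (a ∷ p) (b ∷ w) = (a =ˢ b) ∧ isPrefix p w

-- number of occurrences of p in w as a block of consecutive steps
-- (occurrences at all positions, overlaps allowed)
occ : Word → Word → ℕ
occ p [] = if isPrefix p [] then 1 else 0
occ p (a ∷ w) = (if isPrefix p (a ∷ w) then 1 else 0) + occ p w

UU DD UFU : Word
UU = U ∷ U ∷ []
DD = D ∷ D ∷ []
UFU = U ∷ F ∷ U ∷ []

InMnUU : ℕ → Word → Set
InMnUU n w = (length w ≡ n) × IsMotzkin w × (occ UU w ≡ 0)

MnUU : ℕ → Set
MnUU n = Σ Word (InMnUU n)

allWords : ℕ → List Word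
allWords zero = [] ∷ []
allWords (suc n) = concatMap (λ w → (U ∷ w) ∷ (F ∷ w) ∷ (D ∷ w) ∷ []) (allWords n)

motzkinFrom? : ℕ → Word → Bool
motzkinFrom? zero [] = true
motzkinFrom? (suc _) [] = false
motzkinFrom? h (U ∷ w) = motzkinFrom? (suc h) w
motzkinFrom? h (F ∷ w) = motzkinFrom? h w
motzkinFrom? zero (D ∷ w) = false
motzkinFrom? (suc h) (D ∷ w) = motzkinFrom? h w

_==ℕ_ : ℕ → ℕ → Bool
zero ==ℕ zero = true
suc m ==ℕ suc n = m ==ℕ n
_ ==ℕ _ = false

countStat : ℕ → Word → ℕ → ℕ
countStat n p k = length (filter (λ w → T? (motzkinFrom? zero w ∧ (occ UU w ==ℕ 0) ∧ (occ p w ==ℕ k))) (allWords n))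

module Submission where

-- A Motzkin path avoiding UU factors uniquely into the tiles UF, UD, F and D, and its tile word is a walk
-- in which UF rises, D falls and UD, F stay level. Reversing the tile word while exchanging UF and D reverses
-- the walk, so it gives an involution ψ of M_n(UU); length is kept because the exchange narrows each rising
-- tile and widens each falling one by one step. An occurrence of UFU is exactly a UF tile followed by a tile
-- starting with U, an occurrence of DD a tile ending in D followed by a D tile, and the reversal turns the
-- first kind of junction into the second; so ψ maps the paths with k UFUs bijectively onto those with k DDs.

open import Defs
open import Data.Bool using (Bool; true; false; T; T?; if_then_else_; _∧_)
open import Data.Bool.Properties using (∧-comm)
open import Data.List using (List; []; _∷_; _++_; _∷ʳ_; length; map; filter; reverse; concatMap)
open import Data.List.Properties
  using (length-++; length-map; ++-assoc; unfold-reverse; reverse-map; reverse-involutive; map-∘; map-cong; map-id;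
         ∷-injectiveˡ; ∷-injectiveʳ)
open import Data.List.Membership.Propositional using (_∈_; find)
open import Data.List.Membership.Propositional.Properties
  using (∈-map⁺; ∈-map⁻; ∈-filter⁺; ∈-filter⁻; ∈-concatMap⁺; ∈-concatMap⁻)
open import Data.List.Membership.Propositional.Properties.WithK using (unique∧set⇒bag)
open import Data.List.Relation.Binary.BagAndSetEquality using (∼bag⇒↭)
open import Data.List.Relation.Binary.Disjoint.Propositional using (Disjoint)
open import Data.List.Relation.Binary.Permutation.Propositional.Properties using (↭-reverse; ↭-length)
open import Data.List.Relation.Unary.All as All using ([]; _∷_)
import Data.List.Relation.Unary.All.Properties as All
import Data.List.Relation.Unary.AllPairs as AllPairs
import Data.List.Relation.Unary.AllPairs.Properties as AllPairs
open import Data.List.Relation.Unary.Any as Any using (here; there)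
open import Data.List.Relation.Unary.Unique.Propositional using (Unique; []; _∷_)
import Data.List.Relation.Unary.Unique.Propositional.Properties as Unique
open import Data.Nat using (ℕ; zero; suc; _+_)
open import Data.Nat.ListAction using (sum)
open import Data.Nat.ListAction.Properties using (sum-↭)
open import Data.Nat.Properties using (+-assoc; +-comm; +-suc; +-identityʳ)
open import Data.Product using (Σ; ∃-syntax; _×_; _,_; proj₁)
open import Function using (_∘_; flip; id)
open import Function.Bundles using (mk⇔)
open import Relation.Binary.PropositionalEquality
open import Relation.Nullary using (¬_; Dec; yes; no; _because_; does)
open import Relation.Nullary.Decidable using (dec-true; dec-false)
open import Relation.Nullary.Reflects using (Reflects; ofʸ; ofⁿ; fromEquivalence; _×-reflects_)

module _ {A : Set} where

  sumAdjacentFrom : (A → A → ℕ) → A → List A → ℕ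
  sumAdjacentFrom f x []       = 0
  sumAdjacentFrom f x (y ∷ ys) = f x y + sumAdjacentFrom f y ys

  sumAdjacent : (A → A → ℕ) → List A → ℕ
  sumAdjacent f []       = 0
  sumAdjacent f (x ∷ xs) = sumAdjacentFrom f x xs

  sumAdjacentFrom-cong : ∀ {f g : A → A → ℕ} → (∀ x y → f x y ≡ g x y) →
                         ∀ x xs → sumAdjacentFrom f x xs ≡ sumAdjacentFrom g x xs
  sumAdjacentFrom-cong f≗g x []       = refl
  sumAdjacentFrom-cong f≗g x (y ∷ ys) = cong₂ _+_ (f≗g x y) (sumAdjacentFrom-cong f≗g y ys)

  sumAdjacent-cong : ∀ {f g : A → A → ℕ} → (∀ x y → f x y ≡ g x y) →
                     ∀ xs → sumAdjacent f xs ≡ sumAdjacent g xs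
  sumAdjacent-cong f≗g []       = refl
  sumAdjacent-cong f≗g (x ∷ xs) = sumAdjacentFrom-cong f≗g x xs

  sumAdjacent-map : ∀ (f : A → A → ℕ) g xs →
                    sumAdjacent f (map g xs) ≡ sumAdjacent (λ x y → f (g x) (g y)) xs
  sumAdjacent-map f g []       = refl
  sumAdjacent-map f g (x ∷ xs) = from x xs
    where
    from : ∀ x xs → sumAdjacentFrom f (g x) (map g xs) ≡ sumAdjacentFrom (λ x y → f (g x) (g y)) x xs
    from x []       = refl
    from x (y ∷ ys) = cong (f (g x) (g y) +_) (from y ys)

  sumAdjacent-reverse-++ : ∀ (f : A → A → ℕ) x xs zs →
    sumAdjacent f (reverse xs ++ x ∷ zs) ≡ sumAdjacentFrom (flip f) x xs + sumAdjacentFrom f x zs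
  sumAdjacent-reverse-++ f x []       zs = refl
  sumAdjacent-reverse-++ f x (y ∷ ys) zs = begin
    sumAdjacent f (reverse (y ∷ ys) ++ x ∷ zs)   ≡⟨ cong (λ l → sumAdjacent f (l ++ x ∷ zs)) (unfold-reverse y ys) ⟩
    sumAdjacent f ((reverse ys ∷ʳ y) ++ x ∷ zs)  ≡⟨ cong (sumAdjacent f) (++-assoc (reverse ys) (y ∷ []) (x ∷ zs)) ⟩
    sumAdjacent f (reverse ys ++ y ∷ x ∷ zs)     ≡⟨ sumAdjacent-reverse-++ f y ys (x ∷ zs) ⟩
    before + (f y x + after)                     ≡⟨ +-assoc before (f y x) after ⟨
    before + f y x + after                       ≡⟨ cong (_+ after) (+-comm before (f y x)) ⟩
    f y x + before + after                       ∎
    where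
    open ≡-Reasoning
    before = sumAdjacentFrom (flip f) y ys
    after  = sumAdjacentFrom f x zs

  sumAdjacent-reverse : ∀ (f : A → A → ℕ) xs → sumAdjacent f (reverse xs) ≡ sumAdjacent (flip f) xs
  sumAdjacent-reverse f []       = refl
  sumAdjacent-reverse f (x ∷ xs) = begin
    sumAdjacent f (reverse (x ∷ xs))      ≡⟨ cong (sumAdjacent f) (unfold-reverse x xs) ⟩
    sumAdjacent f (reverse xs ++ x ∷ [])  ≡⟨ sumAdjacent-reverse-++ f x xs [] ⟩
    sumAdjacentFrom (flip f) x xs + 0     ≡⟨ +-identityʳ _ ⟩
    sumAdjacentFrom (flip f) x xs         ∎
    where open ≡-Reasoning

module _ {A : Set} {P Q : A → Set} (P? : ∀ x → Dec (P x)) (Q? : ∀ x → Dec (Q x)) where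

  length-filter-involution : ∀ (g : A → A) (xs : List A) → Unique xs → (∀ x → g (g x) ≡ x) →
    (∀ {x} → x ∈ xs → g x ∈ xs) → (∀ x → P x → Q (g x)) → (∀ x → Q x → P (g x)) →
    length (filter P? xs) ≡ length (filter Q? xs)
  length-filter-involution g xs xs! g∘g g-closed P⇒Qg Q⇒Pg = begin
    length (filter P? xs)          ≡⟨ length-map g (filter P? xs) ⟨
    length (map g (filter P? xs))  ≡⟨ ↭-length (∼bag⇒↭ (unique∧set⇒bag gPxs! Qxs! (mk⇔ to from))) ⟩
    length (filter Q? xs)          ∎
    where
    open ≡-Reasoning
    gPxs! : Unique (map g (filter P? xs))
    gPxs! = Unique.map⁺ g-injective (Unique.filter⁺ P? xs!)
      where
      g-injective : ∀ {x y} → g x ≡ g y → x ≡ y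
      g-injective {x} {y} gx≡gy = trans (sym (g∘g x)) (trans (cong g gx≡gy) (g∘g y))
    Qxs! : Unique (filter Q? xs)
    Qxs! = Unique.filter⁺ Q? xs!
    to : ∀ {v} → v ∈ map g (filter P? xs) → v ∈ filter Q? xs
    to v∈ with ∈-map⁻ g v∈
    ... | x , x∈ , refl with ∈-filter⁻ P? x∈
    ... | x∈xs , Px = ∈-filter⁺ Q? (g-closed x∈xs) (P⇒Qg x Px)
    from : ∀ {v} → v ∈ filter Q? xs → v ∈ map g (filter P? xs)
    from {v} v∈ with ∈-filter⁻ Q? v∈
    ... | v∈xs , Qv =
      subst (_∈ map g (filter P? xs)) (g∘g v) (∈-map⁺ g (∈-filter⁺ P? (g-closed v∈xs) (Q⇒Pg v Qv)))

T⇒reflected : ∀ {A : Set} {b} → Reflects A b → T b → A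
T⇒reflected (ofʸ a) _ = a

reflected⇒T : ∀ {A : Set} {b} → Reflects A b → A → T b
reflected⇒T (ofʸ _)  _ = _
reflected⇒T (ofⁿ ¬a) a = ¬a a

data Tile : Set where
  ⟨UF⟩ ⟨UD⟩ ⟨F⟩ ⟨D⟩ : Tile

steps : Tile → Word
steps ⟨UF⟩ = U ∷ F ∷ []
steps ⟨UD⟩ = U ∷ D ∷ []
steps ⟨F⟩  = F ∷ []
steps ⟨D⟩  = D ∷ []

expand : List Tile → Word
expand = concatMap steps

-- A left inverse of expand; its value on words outside the image of expand is junk.
tiles : Word → List Tile
tiles []          = []
tiles (U ∷ F ∷ w) = ⟨UF⟩ ∷ tiles w
tiles (U ∷ D ∷ w) = ⟨UD⟩ ∷ tiles w
tiles (U ∷ _)     = []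
tiles (F ∷ w)     = ⟨F⟩ ∷ tiles w
tiles (D ∷ w)     = ⟨D⟩ ∷ tiles w

tiles-expand : ∀ ts → tiles (expand ts) ≡ ts
tiles-expand []          = refl
tiles-expand (⟨UF⟩ ∷ ts) = cong (⟨UF⟩ ∷_) (tiles-expand ts)
tiles-expand (⟨UD⟩ ∷ ts) = cong (⟨UD⟩ ∷_) (tiles-expand ts)
tiles-expand (⟨F⟩ ∷ ts)  = cong (⟨F⟩ ∷_) (tiles-expand ts)
tiles-expand (⟨D⟩ ∷ ts)  = cong (⟨D⟩ ∷_) (tiles-expand ts)

data Walk : ℕ → ℕ → List Tile → Set where
  []   : ∀ {h} → Walk h h []
  uf∷_ : ∀ {h h′ ts} → Walk (suc h) h′ ts → Walk h h′ (⟨UF⟩ ∷ ts)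
  ud∷_ : ∀ {h h′ ts} → Walk h h′ ts → Walk h h′ (⟨UD⟩ ∷ ts)
  f∷_  : ∀ {h h′ ts} → Walk h h′ ts → Walk h h′ (⟨F⟩ ∷ ts)
  d∷_  : ∀ {h h′ ts} → Walk h h′ ts → Walk (suc h) h′ (⟨D⟩ ∷ ts)

walk-++ : ∀ {h m h′ xs ys} → Walk h m xs → Walk m h′ ys → Walk h h′ (xs ++ ys)
walk-++ []       q = q
walk-++ (uf∷ p) q = uf∷ walk-++ p q
walk-++ (ud∷ p) q = ud∷ walk-++ p q
walk-++ (f∷ p)  q = f∷ walk-++ p q
walk-++ (d∷ p)  q = d∷ walk-++ p q

walk⇒motzkin : ∀ {h ts} → Walk h 0 ts → MotzkinFrom h (expand ts)
walk⇒motzkin []       = done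
walk⇒motzkin (uf∷ p) = up (flat (walk⇒motzkin p))
walk⇒motzkin (ud∷ p) = up (down (walk⇒motzkin p))
walk⇒motzkin (f∷ p)  = flat (walk⇒motzkin p)
walk⇒motzkin (d∷ p)  = down (walk⇒motzkin p)

expand-avoids-UU : ∀ ts → occ UU (expand ts) ≡ 0
expand-avoids-UU []          = refl
expand-avoids-UU (⟨UF⟩ ∷ ts) = expand-avoids-UU ts
expand-avoids-UU (⟨UD⟩ ∷ ts) = expand-avoids-UU ts
expand-avoids-UU (⟨F⟩ ∷ ts)  = expand-avoids-UU ts
expand-avoids-UU (⟨D⟩ ∷ ts)  = expand-avoids-UU ts

data Tiling (h : ℕ) : Word → Set where
  tiling : ∀ {ts} → Walk h 0 ts → Tiling h (expand ts)

motzkin⇒tiling : ∀ {h w} → MotzkinFrom h w → occ UU w ≡ 0 → Tiling h w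
motzkin⇒tiling done          _ = tiling []
motzkin⇒tiling (up (up _))   ()
motzkin⇒tiling (up (flat m)) u with motzkin⇒tiling m u
... | tiling p = tiling (uf∷ p)
motzkin⇒tiling (up (down m)) u with motzkin⇒tiling m u
... | tiling p = tiling (ud∷ p)
motzkin⇒tiling (flat m)      u with motzkin⇒tiling m u
... | tiling p = tiling (f∷ p)
motzkin⇒tiling (down m)      u with motzkin⇒tiling m u
... | tiling p = tiling (d∷ p)

converse : Tile → Tile
converse ⟨UF⟩ = ⟨D⟩
converse ⟨UD⟩ = ⟨UD⟩
converse ⟨F⟩  = ⟨F⟩
converse ⟨D⟩  = ⟨UF⟩

converse-involutive : ∀ t → converse (converse t) ≡ t
converse-involutive ⟨UF⟩ = refl
converse-involutive ⟨UD⟩ = refl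
converse-involutive ⟨F⟩  = refl
converse-involutive ⟨D⟩  = refl

mirror : List Tile → List Tile
mirror = reverse ∘ map converse

mirror-involutive : ∀ ts → mirror (mirror ts) ≡ ts
mirror-involutive ts = begin
  reverse (map converse (reverse (map converse ts)))  ≡⟨ cong reverse (reverse-map converse (map converse ts)) ⟩
  reverse (reverse (map converse (map converse ts)))  ≡⟨ reverse-involutive _ ⟩
  map converse (map converse ts)                       ≡⟨ map-∘ ts ⟨
  map (converse ∘ converse) ts                         ≡⟨ map-cong converse-involutive ts ⟩
  map id ts                                            ≡⟨ map-id ts ⟩
  ts                                                   ∎
  where open ≡-Reasoning

mirror-∷ : ∀ t ts → mirror (t ∷ ts) ≡ mirror ts ∷ʳ converse t
mirror-∷ t ts = unfold-reverse (converse t) (map converse ts)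

walk-mirror : ∀ {h h′ ts} → Walk h h′ ts → Walk h′ h (mirror ts)
walk-mirror []                  = []
walk-mirror (uf∷_ {ts = ts} p) = subst (Walk _ _) (sym (mirror-∷ ⟨UF⟩ ts)) (walk-++ (walk-mirror p) (d∷ []))
walk-mirror (ud∷_ {ts = ts} p) = subst (Walk _ _) (sym (mirror-∷ ⟨UD⟩ ts)) (walk-++ (walk-mirror p) (ud∷ []))
walk-mirror (f∷_ {ts = ts} p)  = subst (Walk _ _) (sym (mirror-∷ ⟨F⟩ ts)) (walk-++ (walk-mirror p) (f∷ []))
walk-mirror (d∷_ {ts = ts} p)  = subst (Walk _ _) (sym (mirror-∷ ⟨D⟩ ts)) (walk-++ (walk-mirror p) (uf∷ []))

width : Tile → ℕ
width = length ∘ steps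

length-expand : ∀ ts → length (expand ts) ≡ sum (map width ts)
length-expand []       = refl
length-expand (t ∷ ts) = trans (length-++ (steps t)) (cong (width t +_) (length-expand ts))

length-expand-mirror : ∀ ts → length (expand (mirror ts)) ≡ sum (map (width ∘ converse) ts)
length-expand-mirror ts = begin
  length (expand (mirror ts))                    ≡⟨ length-expand (mirror ts) ⟩
  sum (map width (reverse (map converse ts)))    ≡⟨ cong sum (reverse-map width (map converse ts)) ⟩
  sum (reverse (map width (map converse ts)))    ≡⟨ sum-↭ (↭-reverse (map width (map converse ts))) ⟩
  sum (map width (map converse ts))              ≡⟨ cong sum (map-∘ ts) ⟨
  sum (map (width ∘ converse) ts)                ∎
  where open ≡-Reasoning

walk-width-converse : ∀ {h h′ ts} → Walk h h′ ts → sum (map (width ∘ converse) ts) + h′ ≡ sum (map width ts) + h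
walk-width-converse []                        = refl
walk-width-converse (uf∷_ {h} {ts = ts} p)    = cong suc (trans (walk-width-converse p) (+-suc (sum (map width ts)) h))
walk-width-converse (ud∷ p)                   = cong (2 +_) (walk-width-converse p)
walk-width-converse (f∷ p)                    = cong suc (walk-width-converse p)
walk-width-converse {suc h} (d∷_ {ts = ts} p) =
  cong suc (trans (cong suc (walk-width-converse p)) (sym (+-suc (sum (map width ts)) h)))

length-mirror : ∀ {ts} → Walk 0 0 ts → length (expand (mirror ts)) ≡ length (expand ts)
length-mirror {ts} p = begin
  length (expand (mirror ts))          ≡⟨ length-expand-mirror ts ⟩
  sum (map (width ∘ converse) ts)      ≡⟨ +-identityʳ _ ⟨
  sum (map (width ∘ converse) ts) + 0  ≡⟨ walk-width-converse p ⟩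
  sum (map width ts) + 0               ≡⟨ +-identityʳ _ ⟩
  sum (map width ts)                   ≡⟨ length-expand ts ⟨
  length (expand ts)                   ∎
  where open ≡-Reasoning

startsWithU endsWithD isUF isD : Tile → Bool
startsWithU ⟨UF⟩ = true
startsWithU ⟨UD⟩ = true
startsWithU _    = false
endsWithD ⟨UD⟩ = true
endsWithD ⟨D⟩  = true
endsWithD _    = false
isUF ⟨UF⟩ = true
isUF _    = false
isD ⟨D⟩ = true
isD _   = false

endsWithD-converse : ∀ t → endsWithD (converse t) ≡ startsWithU t
endsWithD-converse ⟨UF⟩ = refl
endsWithD-converse ⟨UD⟩ = refl
endsWithD-converse ⟨F⟩  = refl
endsWithD-converse ⟨D⟩  = refl

isD-converse : ∀ t → isD (converse t) ≡ isUF t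
isD-converse ⟨UF⟩ = refl
isD-converse ⟨UD⟩ = refl
isD-converse ⟨F⟩  = refl
isD-converse ⟨D⟩  = refl

χ : Bool → ℕ
χ b = if b then 1 else 0

UFU-across DD-across : Tile → Tile → ℕ
UFU-across t t′ = χ (isUF t ∧ startsWithU t′)
DD-across  t t′ = χ (endsWithD t ∧ isD t′)

DD-across-converse : ∀ t t′ → DD-across (converse t′) (converse t) ≡ UFU-across t t′
DD-across-converse t t′ =
  cong χ (trans (cong₂ _∧_ (endsWithD-converse t′) (isD-converse t)) (∧-comm (startsWithU t′) (isUF t)))

occ-UFU-expand-∷ : ∀ t ts → occ UFU (expand (t ∷ ts)) ≡ sumAdjacentFrom UFU-across t ts
occ-UFU-expand-∷ ⟨UF⟩ []          = refl
occ-UFU-expand-∷ ⟨UF⟩ (⟨UF⟩ ∷ ts) = cong suc (occ-UFU-expand-∷ ⟨UF⟩ ts)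
occ-UFU-expand-∷ ⟨UF⟩ (⟨UD⟩ ∷ ts) = cong suc (occ-UFU-expand-∷ ⟨UD⟩ ts)
occ-UFU-expand-∷ ⟨UF⟩ (⟨F⟩ ∷ ts)  = occ-UFU-expand-∷ ⟨F⟩ ts
occ-UFU-expand-∷ ⟨UF⟩ (⟨D⟩ ∷ ts)  = occ-UFU-expand-∷ ⟨D⟩ ts
occ-UFU-expand-∷ ⟨UD⟩ []          = refl
occ-UFU-expand-∷ ⟨UD⟩ (t ∷ ts)    = occ-UFU-expand-∷ t ts
occ-UFU-expand-∷ ⟨F⟩  []          = refl
occ-UFU-expand-∷ ⟨F⟩  (t ∷ ts)    = occ-UFU-expand-∷ t ts
occ-UFU-expand-∷ ⟨D⟩  []          = refl
occ-UFU-expand-∷ ⟨D⟩  (t ∷ ts)    = occ-UFU-expand-∷ t ts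

occ-DD-expand-∷ : ∀ t ts → occ DD (expand (t ∷ ts)) ≡ sumAdjacentFrom DD-across t ts
occ-DD-expand-∷ ⟨UF⟩ []          = refl
occ-DD-expand-∷ ⟨UF⟩ (t ∷ ts)    = occ-DD-expand-∷ t ts
occ-DD-expand-∷ ⟨UD⟩ []          = refl
occ-DD-expand-∷ ⟨UD⟩ (⟨UF⟩ ∷ ts) = occ-DD-expand-∷ ⟨UF⟩ ts
occ-DD-expand-∷ ⟨UD⟩ (⟨UD⟩ ∷ ts) = occ-DD-expand-∷ ⟨UD⟩ ts
occ-DD-expand-∷ ⟨UD⟩ (⟨F⟩ ∷ ts)  = occ-DD-expand-∷ ⟨F⟩ ts
occ-DD-expand-∷ ⟨UD⟩ (⟨D⟩ ∷ ts)  = cong suc (occ-DD-expand-∷ ⟨D⟩ ts)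
occ-DD-expand-∷ ⟨F⟩  []          = refl
occ-DD-expand-∷ ⟨F⟩  (t ∷ ts)    = occ-DD-expand-∷ t ts
occ-DD-expand-∷ ⟨D⟩  []          = refl
occ-DD-expand-∷ ⟨D⟩  (⟨UF⟩ ∷ ts) = occ-DD-expand-∷ ⟨UF⟩ ts
occ-DD-expand-∷ ⟨D⟩  (⟨UD⟩ ∷ ts) = occ-DD-expand-∷ ⟨UD⟩ ts
occ-DD-expand-∷ ⟨D⟩  (⟨F⟩ ∷ ts)  = occ-DD-expand-∷ ⟨F⟩ ts
occ-DD-expand-∷ ⟨D⟩  (⟨D⟩ ∷ ts)  = cong suc (occ-DD-expand-∷ ⟨D⟩ ts)

occ-UFU-expand : ∀ ts → occ UFU (expand ts) ≡ sumAdjacent UFU-across ts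
occ-UFU-expand []       = refl
occ-UFU-expand (t ∷ ts) = occ-UFU-expand-∷ t ts

occ-DD-expand : ∀ ts → occ DD (expand ts) ≡ sumAdjacent DD-across ts
occ-DD-expand []       = refl
occ-DD-expand (t ∷ ts) = occ-DD-expand-∷ t ts

occ-DD-mirror : ∀ ts → occ DD (expand (mirror ts)) ≡ occ UFU (expand ts)
occ-DD-mirror ts = begin
  occ DD (expand (mirror ts))                                         ≡⟨ occ-DD-expand (mirror ts) ⟩
  sumAdjacent DD-across (reverse (map converse ts))                   ≡⟨ sumAdjacent-reverse DD-across (map converse ts) ⟩
  sumAdjacent (flip DD-across) (map converse ts)                      ≡⟨ sumAdjacent-map (flip DD-across) converse ts ⟩
  sumAdjacent (λ t t′ → DD-across (converse t′) (converse t)) ts      ≡⟨ sumAdjacent-cong DD-across-converse ts ⟩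
  sumAdjacent UFU-across ts                                           ≡⟨ occ-UFU-expand ts ⟨
  occ UFU (expand ts)                                                 ∎
  where open ≡-Reasoning

Valid : Word → Set
Valid w = IsMotzkin w × occ UU w ≡ 0

mirrorWord : Word → Word
mirrorWord w = expand (mirror (tiles w))

mirrorWord-expand : ∀ ts → mirrorWord (expand ts) ≡ expand (mirror ts)
mirrorWord-expand ts = cong (expand ∘ mirror) (tiles-expand ts)

mirrorWord-valid : ∀ {w} → Valid w → Valid (mirrorWord w)
mirrorWord-valid (m , u) with motzkin⇒tiling m u
... | tiling {ts} p rewrite mirrorWord-expand ts = walk⇒motzkin (walk-mirror p) , expand-avoids-UU (mirror ts)

mirrorWord-involutive : ∀ {w} → Valid w → mirrorWord (mirrorWord w) ≡ w
mirrorWord-involutive (m , u) with motzkin⇒tiling m u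
... | tiling {ts} _ rewrite mirrorWord-expand ts | mirrorWord-expand (mirror ts) = cong expand (mirror-involutive ts)

length-mirrorWord : ∀ {w} → Valid w → length (mirrorWord w) ≡ length w
length-mirrorWord (m , u) with motzkin⇒tiling m u
... | tiling {ts} p rewrite mirrorWord-expand ts = length-mirror p

occ-DD-mirrorWord : ∀ {w} → Valid w → occ DD (mirrorWord w) ≡ occ UFU w
occ-DD-mirrorWord (m , u) with motzkin⇒tiling m u
... | tiling {ts} _ rewrite mirrorWord-expand ts = occ-DD-mirror ts

motzkinFrom?-sound : ∀ h w → T (motzkinFrom? h w) → MotzkinFrom h w
motzkinFrom?-sound zero    []      _ = done
motzkinFrom?-sound zero    (U ∷ w) t = up (motzkinFrom?-sound 1 w t)
motzkinFrom?-sound (suc h) (U ∷ w) t = up (motzkinFrom?-sound (suc (suc h)) w t)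
motzkinFrom?-sound zero    (F ∷ w) t = flat (motzkinFrom?-sound zero w t)
motzkinFrom?-sound (suc h) (F ∷ w) t = flat (motzkinFrom?-sound (suc h) w t)
motzkinFrom?-sound (suc h) (D ∷ w) t = down (motzkinFrom?-sound h w t)

motzkinFrom?-complete : ∀ {h w} → MotzkinFrom h w → T (motzkinFrom? h w)
motzkinFrom?-complete done             = _
motzkinFrom?-complete {zero}  (up m)   = motzkinFrom?-complete m
motzkinFrom?-complete {suc h} (up m)   = motzkinFrom?-complete m
motzkinFrom?-complete {zero}  (flat m) = motzkinFrom?-complete m
motzkinFrom?-complete {suc h} (flat m) = motzkinFrom?-complete m
motzkinFrom?-complete (down m)         = motzkinFrom?-complete m

motzkinFrom?-reflects : ∀ h w → Reflects (MotzkinFrom h w) (motzkinFrom? h w)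
motzkinFrom?-reflects h w = fromEquivalence (motzkinFrom?-sound h w) motzkinFrom?-complete

==ℕ-sound : ∀ m n → T (m ==ℕ n) → m ≡ n
==ℕ-sound zero    zero    _ = refl
==ℕ-sound (suc m) (suc n) t = cong suc (==ℕ-sound m n t)

==ℕ-complete : ∀ n → T (n ==ℕ n)
==ℕ-complete zero    = _
==ℕ-complete (suc n) = ==ℕ-complete n

==ℕ-reflects : ∀ m n → Reflects (m ≡ n) (m ==ℕ n)
==ℕ-reflects m n = fromEquivalence (==ℕ-sound m n) (λ { refl → ==ℕ-complete m })

valid? : ∀ w → Dec (Valid w)
valid? w = _ because (motzkinFrom?-reflects zero w ×-reflects ==ℕ-reflects (occ UU w) 0)

Counted : Word → ℕ → Word → Set
Counted p k w = IsMotzkin w × occ UU w ≡ 0 × occ p w ≡ k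

counted : Word → ℕ → Word → Bool
counted p k w = motzkinFrom? zero w ∧ (occ UU w ==ℕ 0) ∧ (occ p w ==ℕ k)

Counted-reflects : ∀ p k w → Reflects (Counted p k w) (counted p k w)
Counted-reflects p k w =
  motzkinFrom?-reflects zero w ×-reflects ==ℕ-reflects (occ UU w) 0 ×-reflects ==ℕ-reflects (occ p w) k

ψ : Word → Word
ψ w = if does (valid? w) then mirrorWord w else w

ψ-valid : ∀ {w} → Valid w → ψ w ≡ mirrorWord w
ψ-valid {w} v = cong (λ b → if b then mirrorWord w else w) (dec-true (valid? w) v)

ψ-invalid : ∀ {w} → ¬ Valid w → ψ w ≡ w
ψ-invalid {w} ¬v = cong (λ b → if b then mirrorWord w else w) (dec-false (valid? w) ¬v)

ψ-preserves-Valid : ∀ {w} → Valid w → Valid (ψ w)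
ψ-preserves-Valid v = subst Valid (sym (ψ-valid v)) (mirrorWord-valid v)

ψ-involutive : ∀ w → ψ (ψ w) ≡ w
ψ-involutive w with valid? w
... | yes v  = begin
  ψ (ψ w)                    ≡⟨ ψ-valid (ψ-preserves-Valid v) ⟩
  mirrorWord (ψ w)           ≡⟨ cong mirrorWord (ψ-valid v) ⟩
  mirrorWord (mirrorWord w)  ≡⟨ mirrorWord-involutive v ⟩
  w                          ∎
  where open ≡-Reasoning
... | no ¬v  = trans (cong ψ (ψ-invalid ¬v)) (ψ-invalid ¬v)

length-ψ : ∀ w → length (ψ w) ≡ length w
length-ψ w with valid? w
... | yes v  = trans (cong length (ψ-valid v)) (length-mirrorWord v)
... | no ¬v  = cong length (ψ-invalid ¬v)

occ-DD-ψ : ∀ {w} → Valid w → occ DD (ψ w) ≡ occ UFU w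
occ-DD-ψ v = trans (cong (occ DD) (ψ-valid v)) (occ-DD-mirrorWord v)

occ-UFU-ψ : ∀ {w} → Valid w → occ UFU (ψ w) ≡ occ DD w
occ-UFU-ψ {w} v = trans (sym (occ-DD-ψ (ψ-preserves-Valid v))) (cong (occ DD) (ψ-involutive w))

ψ-Counted-UFU : ∀ {k w} → Counted UFU k w → Counted DD k (ψ w)
ψ-Counted-UFU (m , u , o) = let m′ , u′ = ψ-preserves-Valid (m , u) in m′ , u′ , trans (occ-DD-ψ (m , u)) o

ψ-Counted-DD : ∀ {k w} → Counted DD k w → Counted UFU k (ψ w)
ψ-Counted-DD (m , u , o) = let m′ , u′ = ψ-preserves-Valid (m , u) in m′ , u′ , trans (occ-UFU-ψ (m , u)) o

prefixes : Word → List Word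
prefixes w = map (_∷ w) (U ∷ F ∷ D ∷ [])

∈-allWords⁺ : ∀ w → w ∈ allWords (length w)
∈-allWords⁺ []      = here refl
∈-allWords⁺ (s ∷ w) = ∈-concatMap⁺ prefixes (Any.map (λ { refl → s∷w∈prefixes s }) (∈-allWords⁺ w))
  where
  s∷w∈prefixes : ∀ s → (s ∷ w) ∈ prefixes w
  s∷w∈prefixes U = here refl
  s∷w∈prefixes F = there (here refl)
  s∷w∈prefixes D = there (there (here refl))

∈-allWords⁻ : ∀ n {v} → v ∈ allWords n → length v ≡ n
∈-allWords⁻ zero    (here refl) = refl
∈-allWords⁻ (suc n) v∈ with find (∈-concatMap⁻ prefixes {xs = allWords n} v∈)
... | w , w∈ , v∈prefixes with ∈-map⁻ (_∷ w) v∈prefixes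
... | _ , _ , refl = cong suc (∈-allWords⁻ n w∈)

allWords-unique : ∀ n → Unique (allWords n)
allWords-unique zero    = [] ∷ []
allWords-unique (suc n) =
  Unique.concat⁺ (All.map⁺ (All.universal prefixes-unique (allWords n)))
                 (AllPairs.map⁺ (AllPairs.map prefixes-disjoint (allWords-unique n)))
  where
  prefixes-unique : ∀ w → Unique (prefixes w)
  prefixes-unique w = Unique.map⁺ (∷-injectiveˡ {xs = w}) (((λ ()) ∷ (λ ()) ∷ []) ∷ ((λ ()) ∷ []) ∷ [] ∷ [])
  prefixes-disjoint : ∀ {w w′} → w ≢ w′ → Disjoint (prefixes w) (prefixes w′)
  prefixes-disjoint {w} {w′} w≢w′ (v∈ , v∈′) with ∈-map⁻ (_∷ w) v∈ | ∈-map⁻ (_∷ w′) v∈′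
  ... | _ , _ , refl | _ , _ , eq = w≢w′ (∷-injectiveʳ eq)

ψ-closed-allWords : ∀ n {w} → w ∈ allWords n → ψ w ∈ allWords n
ψ-closed-allWords n {w} w∈ =
  subst (λ m → ψ w ∈ allWords m) (trans (length-ψ w) (∈-allWords⁻ n w∈)) (∈-allWords⁺ (ψ w))

countStat-UFU≡DD : ∀ n k → countStat n UFU k ≡ countStat n DD k
countStat-UFU≡DD n k =
  length-filter-involution (T? ∘ counted UFU k) (T? ∘ counted DD k) ψ (allWords n) (allWords-unique n) ψ-involutive
    (ψ-closed-allWords n) (onReflected ψ-Counted-UFU) (onReflected ψ-Counted-DD)
  where
  onReflected : ∀ {p q} → (∀ {w} → Counted p k w → Counted q k (ψ w)) →
                ∀ w → T (counted p k w) → T (counted q k (ψ w))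
  onReflected {p} {q} f w =
    reflected⇒T (Counted-reflects q k (ψ w)) ∘ f ∘ T⇒reflected (Counted-reflects p k w)

ψₙ : ∀ n → MnUU n → MnUU n
ψₙ n (w , len , v) = ψ w , trans (length-ψ w) len , ψ-preserves-Valid v

mainTheorem6 : (n : ℕ) →
    Σ (MnUU n → MnUU n) (λ ψ →
      ((P : MnUU n) → proj₁ (ψ (ψ P)) ≡ proj₁ P) ×
      ((P : MnUU n) → occ DD (proj₁ (ψ P)) ≡ occ UFU (proj₁ P)))
    × ((k : ℕ) → countStat n UFU k ≡ countStat n DD k)
mainTheorem6 n = (ψₙ n , (λ (w , _) → ψ-involutive w) , (λ (_ , _ , v) → occ-DD-ψ v)) , countStat-UFU≡DD n
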